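{- Let $\mathcal L$ be a summable resource category and let $\partial_X\in\mathcal L(!SX,S!X)$ be a natural transformation satisfying condition (D-with) below. Then for every object $X$: $$S(\mathrm{w}_X)\circ\partial_X=\iota_{0,1}\circ\mathrm{w}_{SX}\qquad\text{and}\qquad S(\mathrm{c}_X)\circ\partial_X=\mathsf m_{!X,!X}\circ(\partial_X\otimes\partial_X)\circ\mathrm{c}_{SX}.$$
   Context: A resource category is a symmetric monoidal category $(\mathcal L,\otimes,1)$, enriched over pointed sets (distinguished zero morphisms $0$ absorbing for composition, with $f\otimes 0=0\otimes f=0$), which is cartesian (terminal object $\top$, binary products $X_0\& X_1$ with projections $\mathrm{pr}_i$ and pairing $\langle-,-\rangle$) and is equipped with a comonad $(!,\mathrm{der},\mathrm{dig})$ and Seely isomorphisms $m^0\in\mathcal L(1,!\top)$, $m^2_{X,Y}\in\mathcal L(!X\otimes!Y,!(X\& Y))$ satisfying the usual axioms of a Seely category (model of linear logic). Weakening and contraction are $\mathrm w_X=(m^0)^{ -1}\circ!0\in\mathcal L(!X,1)$ and $\mathrm c_X=(m^2_{X,X})^{ -1}\circ!\langle\mathrm{id},\mathrm{id}\rangle\in\mathcal L(!X,!X\otimes!X)$. A summability structure $(S,\pi_0,\pi_1,\sigma)$: $S:\mathcal L\to\mathcal L$ functor with $S0=0$, $\pi_0,\pi_1,\sigma:S\Rightarrow\mathrm{Id}$ natural, $\pi_0,\pi_1$ jointly monic; $f_0,f_1\in\mathcal L(X,Y)$ summable if there is (unique) $\langle f_0,f_1\rangle_S\in\mathcal L(X,SY)$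 with $\pi_i\langle f_0,f_1\rangle_S=f_i$, and $f_0+f_1=\sigma\langle f_0,f_1\rangle_S$; axioms: (S-com) $\pi_1,\pi_0$ summable, $\sigma\langle\pi_1,\pi_0\rangle_S=\sigma$; (S-zero) $f,0$ summable with $f+0=f$; (S-witness) if $(f_{00},f_{01}),(f_{10},f_{11})$ and $(f_{00}+f_{01},f_{10}+f_{11})$ are summable then $\langle f_{00},f_{01}\rangle_S,\langle f_{10},f_{11}\rangle_S$ are summable; (S-assoc) $S\sigma_X\circ c_X=\sigma_{SX}$ where $c_X$ is the unique endomorphism of $S^2X$ with $\pi_{i,X}\pi_{j,SX}c_X=\pi_{j,X}\pi_{i,SX}$. A summable resource category is a resource category with a summability structure satisfying (S-dist): if $f_{00},f_{01}\in\mathcal L(X_0,Y_0)$ are summable and $f_1\in\mathcal L(X_1,Y_1)$ then $f_{00}\otimes f_1,f_{01}\otimes f_1$ are summable with sum $(f_{00}+f_{01})\otimes f_1$; and (S-prod): $S$ preserves finite products, i.e. $0\in\mathcal L(S\top,\top)$ and $\langle S\mathrm{pr}_0,S\mathrm{pr}_1\rangle\in\mathcal L(S(X_0\& X_1),SX_0\& SX_1)$ are isos. Notation: $\iota_{0,X}=\langle\mathrm{id},0\rangle_S\in\mathcal L(X,SX)$; $\mathsf m_{X_0,X_1}=\langle\pi_0\otimes\pi_0,\ \pi_1\otimes\pi_0+\pi_0\otimes\pi_1\rangle_S\in\mathcal L(SX_0\otimes SX_1,S(X_0\otimes X_1))$ (the two morphisms being summable by (S-dist)). Condition (D-with) on $\partial$: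 $S((m^0)^{ -1})\circ\partial_\top=\iota_{0,1}\circ(m^0)^{ -1}\circ!0$ (where $!0\in\mathcal L(!S\top,!\top)$), and for all $X_0,X_1$: $S((m^2_{X_0,X_1})^{ -1})\circ\partial_{X_0\& X_1}=\mathsf m_{!X_0,!X_1}\circ(\partial_{X_0}\otimes\partial_{X_1})\circ(m^2_{SX_0,SX_1})^{ -1}\circ!\langle S\mathrm{pr}_0,S\mathrm{pr}_1\rangle$. -}

module Defs where

open import Level using (Level; _⊔_) renaming (suc to lsuc)
open import Data.Bool using (Bool; true; false; if_then_else_)
open import Data.Product using (Σ; _×_; _,_; proj₁; proj₂)
open import Relation.Binary.PropositionalEquality using (_≡_)

record ResourceCategory (o ℓ : Level) : Set (lsuc (o ⊔ ℓ)) where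
  infixr 9 _∘_
  infixr 10 _⊗₁_
  infixr 10 _⊗₀_
  infixr 11 _&_
  field
    Obj : Set o
    Hom : Obj → Obj → Set ℓ
    id  : ∀ {X} → Hom X X
    _∘_ : ∀ {X Y Z} → Hom Y Z → Hom X Y → Hom X Z
    identityˡ : ∀ {X Y} (f : Hom X Y) → id ∘ f ≡ f
    identityʳ : ∀ {X Y} (f : Hom X Y) → f ∘ id ≡ f
    assoc : ∀ {W X Y Z} (h : Hom Y Z) (g : Hom X Y) (f : Hom W X) →
            (h ∘ g) ∘ f ≡ h ∘ (g ∘ f)

    -- enrichment over pointed sets: zero morphisms absorbing for composition
    0m : ∀ {X Y} → Hom X Y
    zeroˡ : ∀ {X Y Z} (f : Hom X Y) → 0m {Y} {Z} ∘ f ≡ 0m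
    zeroʳ : ∀ {X Y Z} (g : Hom Y Z) → g ∘ 0m {X} {Y} ≡ 0m

    𝟙 : Obj
    _⊗₀_ : Obj → Obj → Obj
    _⊗₁_ : ∀ {X X' Y Y'} → Hom X X' → Hom Y Y' → Hom (X ⊗₀ Y) (X' ⊗₀ Y')
    ⊗-id : ∀ {X Y} → id {X} ⊗₁ id {Y} ≡ id
    ⊗-∘  : ∀ {X X' X'' Y Y' Y''} (f' : Hom X' X'') (f : Hom X X')
             (g' : Hom Y' Y'') (g : Hom Y Y') →
           (f' ∘ f) ⊗₁ (g' ∘ g) ≡ (f' ⊗₁ g') ∘ (f ⊗₁ g)
    ⊗-zeroˡ : ∀ {X X' Y Y'} (f : Hom Y Y') → 0m {X} {X'} ⊗₁ f ≡ 0m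
    ⊗-zeroʳ : ∀ {X X' Y Y'} (f : Hom X X') → f ⊗₁ 0m {Y} {Y'} ≡ 0m

    α   : ∀ {X Y Z} → Hom ((X ⊗₀ Y) ⊗₀ Z) (X ⊗₀ (Y ⊗₀ Z))
    α⁻¹ : ∀ {X Y Z} → Hom (X ⊗₀ (Y ⊗₀ Z)) ((X ⊗₀ Y) ⊗₀ Z)
    α-iso₁ : ∀ {X Y Z} → α⁻¹ ∘ α {X} {Y} {Z} ≡ id
    α-iso₂ : ∀ {X Y Z} → α {X} {Y} {Z} ∘ α⁻¹ ≡ id
    α-nat : ∀ {X X' Y Y' Z Z'} (f : Hom X X') (g : Hom Y Y') (h : Hom Z Z') →
            α ∘ ((f ⊗₁ g) ⊗₁ h) ≡ (f ⊗₁ (g ⊗₁ h)) ∘ α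

    lam   : ∀ {X} → Hom (𝟙 ⊗₀ X) X
    lam⁻¹ : ∀ {X} → Hom X (𝟙 ⊗₀ X)
    lam-iso₁ : ∀ {X} → lam⁻¹ ∘ lam {X} ≡ id
    lam-iso₂ : ∀ {X} → lam {X} ∘ lam⁻¹ ≡ id
    lam-nat : ∀ {X Y} (f : Hom X Y) → lam ∘ (id ⊗₁ f) ≡ f ∘ lam

    rho   : ∀ {X} → Hom (X ⊗₀ 𝟙) X
    rho⁻¹ : ∀ {X} → Hom X (X ⊗₀ 𝟙)
    rho-iso₁ : ∀ {X} → rho⁻¹ ∘ rho {X} ≡ id
    rho-iso₂ : ∀ {X} → rho {X} ∘ rho⁻¹ ≡ id
    rho-nat : ∀ {X Y} (f : Hom X Y) → rho ∘ (f ⊗₁ id) ≡ f ∘ rho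

    γ : ∀ {X Y} → Hom (X ⊗₀ Y) (Y ⊗₀ X)
    γ-inv : ∀ {X Y} → γ {Y} {X} ∘ γ {X} {Y} ≡ id
    γ-nat : ∀ {X X' Y Y'} (f : Hom X X') (g : Hom Y Y') →
            γ ∘ (f ⊗₁ g) ≡ (g ⊗₁ f) ∘ γ

    pentagon : ∀ {W X Y Z} →
      (id {W} ⊗₁ α {X} {Y} {Z}) ∘ α ∘ (α ⊗₁ id) ≡ α ∘ α
    triangle : ∀ {X Y} → (id {X} ⊗₁ lam {Y}) ∘ α ≡ rho ⊗₁ id
    hexagon : ∀ {X Y Z} →
      α {Y} {Z} {X} ∘ γ {X} {Y ⊗₀ Z} ∘ α ≡ (id ⊗₁ γ) ∘ α ∘ (γ ⊗₁ id)

    ⊤ : Obj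
    ⊤-unique : ∀ {X} (f g : Hom X ⊤) → f ≡ g
    _&_ : Obj → Obj → Obj
    pr₀ : ∀ {X₀ X₁} → Hom (X₀ & X₁) X₀
    pr₁ : ∀ {X₀ X₁} → Hom (X₀ & X₁) X₁
    ⟨_,_⟩ : ∀ {Y X₀ X₁} → Hom Y X₀ → Hom Y X₁ → Hom Y (X₀ & X₁)
    pr₀-⟨⟩ : ∀ {Y X₀ X₁} (f₀ : Hom Y X₀) (f₁ : Hom Y X₁) → pr₀ ∘ ⟨ f₀ , f₁ ⟩ ≡ f₀
    pr₁-⟨⟩ : ∀ {Y X₀ X₁} (f₀ : Hom Y X₀) (f₁ : Hom Y X₁) → pr₁ ∘ ⟨ f₀ , f₁ ⟩ ≡ f₁
    ⟨⟩-unique : ∀ {Y X₀ X₁} (f₀ : Hom Y X₀) (f₁ : Hom Y X₁) (h : Hom Y (X₀ & X₁)) →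
      pr₀ ∘ h ≡ f₀ → pr₁ ∘ h ≡ f₁ → h ≡ ⟨ f₀ , f₁ ⟩

    !₀ : Obj → Obj
    !₁ : ∀ {X Y} → Hom X Y → Hom (!₀ X) (!₀ Y)
    !-id : ∀ {X} → !₁ (id {X}) ≡ id
    !-∘ : ∀ {X Y Z} (g : Hom Y Z) (f : Hom X Y) → !₁ (g ∘ f) ≡ !₁ g ∘ !₁ f
    der : ∀ {X} → Hom (!₀ X) X
    dig : ∀ {X} → Hom (!₀ X) (!₀ (!₀ X))
    der-nat : ∀ {X Y} (f : Hom X Y) → der ∘ !₁ f ≡ f ∘ der
    dig-nat : ∀ {X Y} (f : Hom X Y) → dig ∘ !₁ f ≡ !₁ (!₁ f) ∘ dig
    comonad-unitˡ : ∀ {X} → der ∘ dig {X} ≡ id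
    comonad-unitʳ : ∀ {X} → !₁ der ∘ dig {X} ≡ id
    comonad-assoc : ∀ {X} → dig ∘ dig {X} ≡ !₁ dig ∘ dig

  _&₁_ : ∀ {X X' Y Y'} → Hom X X' → Hom Y Y' → Hom (X & Y) (X' & Y')
  f &₁ g = ⟨ f ∘ pr₀ , g ∘ pr₁ ⟩

  α& : ∀ {X Y Z} → Hom ((X & Y) & Z) (X & (Y & Z))
  α& = ⟨ pr₀ ∘ pr₀ , ⟨ pr₁ ∘ pr₀ , pr₁ ⟩ ⟩

  field
    m⁰   : Hom 𝟙 (!₀ ⊤)
    m⁰⁻¹ : Hom (!₀ ⊤) 𝟙
    m⁰-iso₁ : m⁰⁻¹ ∘ m⁰ ≡ id
    m⁰-iso₂ : m⁰ ∘ m⁰⁻¹ ≡ id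
    m²   : ∀ {X Y} → Hom (!₀ X ⊗₀ !₀ Y) (!₀ (X & Y))
    m²⁻¹ : ∀ {X Y} → Hom (!₀ (X & Y)) (!₀ X ⊗₀ !₀ Y)
    m²-iso₁ : ∀ {X Y} → m²⁻¹ ∘ m² {X} {Y} ≡ id
    m²-iso₂ : ∀ {X Y} → m² {X} {Y} ∘ m²⁻¹ ≡ id
    m²-nat : ∀ {X X' Y Y'} (f : Hom X X') (g : Hom Y Y') →
             m² ∘ (!₁ f ⊗₁ !₁ g) ≡ !₁ (f &₁ g) ∘ m²
    -- (!, m⁰, m²) is a symmetric monoidal functor (L, &, ⊤) → (L, ⊗, 1)
    m-assoc : ∀ {X Y Z} →
      m² {X} {Y & Z} ∘ (id ⊗₁ m²) ∘ α ≡ !₁ α& ∘ m² ∘ (m² ⊗₁ id)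
    m-unitˡ : ∀ {X} → m² {⊤} {X} ∘ (m⁰ ⊗₁ id) ∘ lam⁻¹ ≡ !₁ ⟨ 0m , id ⟩
    m-unitʳ : ∀ {X} → m² {X} {⊤} ∘ (id ⊗₁ m⁰) ∘ rho⁻¹ ≡ !₁ ⟨ id , 0m ⟩
    m-sym : ∀ {X Y} → m² {Y} {X} ∘ γ ≡ !₁ ⟨ pr₁ , pr₀ ⟩ ∘ m²
    m²-dig : ∀ {X Y} →
      !₁ ⟨ !₁ pr₀ , !₁ pr₁ ⟩ ∘ dig ∘ m² {X} {Y} ≡ m² ∘ (dig ⊗₁ dig)
    m⁰-dig : !₁ (0m { !₀ ⊤ } {⊤}) ∘ dig ∘ m⁰ ≡ m⁰

  w : ∀ X → Hom (!₀ X) 𝟙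
  w X = m⁰⁻¹ ∘ !₁ (0m {X} {⊤})

  c : ∀ X → Hom (!₀ X) (!₀ X ⊗₀ !₀ X)
  c X = m²⁻¹ ∘ !₁ ⟨ id {X} , id ⟩

record SummableResourceCategory (o ℓ : Level) : Set (lsuc (o ⊔ ℓ)) where
  field
    RC : ResourceCategory o ℓ
  open ResourceCategory RC
  field
    S₀ : Obj → Obj
    S₁ : ∀ {X Y} → Hom X Y → Hom (S₀ X) (S₀ Y)
    S-id : ∀ {X} → S₁ (id {X}) ≡ id
    S-∘ : ∀ {X Y Z} (g : Hom Y Z) (f : Hom X Y) → S₁ (g ∘ f) ≡ S₁ g ∘ S₁ f
    S-0 : ∀ {X Y} → S₁ (0m {X} {Y}) ≡ 0m
    π₀ : ∀ {X} → Hom (S₀ X) X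
    π₁ : ∀ {X} → Hom (S₀ X) X
    σ  : ∀ {X} → Hom (S₀ X) X
    π₀-nat : ∀ {X Y} (f : Hom X Y) → π₀ ∘ S₁ f ≡ f ∘ π₀
    π₁-nat : ∀ {X Y} (f : Hom X Y) → π₁ ∘ S₁ f ≡ f ∘ π₁
    σ-nat  : ∀ {X Y} (f : Hom X Y) → σ ∘ S₁ f ≡ f ∘ σ
    π-jointly-monic : ∀ {Y X} (h h' : Hom Y (S₀ X)) →
      π₀ ∘ h ≡ π₀ ∘ h' → π₁ ∘ h ≡ π₁ ∘ h' → h ≡ h'

  -- witnesses of summability (unique, by joint monicity)
  Summable : ∀ {X Y} → Hom X Y → Hom X Y → Set ℓ
  Summable {X} {Y} f₀ f₁ = Σ (Hom X (S₀ Y)) λ h → (π₀ ∘ h ≡ f₀) × (π₁ ∘ h ≡ f₁)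

  π : ∀ {X} → Bool → Hom (S₀ X) X
  π i = if i then π₁ else π₀

  field
    S-com : ∀ {X} → Σ (Summable (π₁ {X}) π₀) λ s → σ ∘ proj₁ s ≡ σ
    S-zero : ∀ {X Y} (f : Hom X Y) → Σ (Summable f 0m) λ s → σ ∘ proj₁ s ≡ f
    S-witness : ∀ {X Y} {f₀₀ f₀₁ f₁₀ f₁₁ : Hom X Y}
      (s₀ : Summable f₀₀ f₀₁) (s₁ : Summable f₁₀ f₁₁) →
      Summable (σ ∘ proj₁ s₀) (σ ∘ proj₁ s₁) → Summable (proj₁ s₀) (proj₁ s₁)
    S-assoc : ∀ {X} (cX : Hom (S₀ (S₀ X)) (S₀ (S₀ X))) →
      (∀ i j → π i ∘ π j ∘ cX ≡ π j ∘ π i) → S₁ σ ∘ cX ≡ σ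
    S-dist : ∀ {X₀ X₁ Y₀ Y₁} {f₀₀ f₀₁ : Hom X₀ Y₀}
      (s : Summable f₀₀ f₀₁) (f₁ : Hom X₁ Y₁) →
      Σ (Summable (f₀₀ ⊗₁ f₁) (f₀₁ ⊗₁ f₁)) λ t → σ ∘ proj₁ t ≡ (σ ∘ proj₁ s) ⊗₁ f₁
    S-prod-⊤ : Σ (Hom ⊤ (S₀ ⊤)) λ g → (g ∘ 0m ≡ id) × (0m ∘ g ≡ id)
    S-prod-& : ∀ {X₀ X₁} →
      Σ (Hom (S₀ X₀ & S₀ X₁) (S₀ (X₀ & X₁))) λ g →
        (g ∘ ⟨ S₁ pr₀ , S₁ pr₁ ⟩ ≡ id) × (⟨ S₁ pr₀ , S₁ pr₁ ⟩ ∘ g ≡ id)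

  -- ι₀ = ⟨ id , 0 ⟩_S
  ι₀ : ∀ X → Hom X (S₀ X)
  ι₀ X = proj₁ (proj₁ (S-zero (id {X})))

  -- h is the morphism m_{X₀,X₁} = ⟨ π₀ ⊗ π₀ , π₁ ⊗ π₀ + π₀ ⊗ π₁ ⟩_S
  IsM : ∀ {X₀ X₁} → Hom (S₀ X₀ ⊗₀ S₀ X₁) (S₀ (X₀ ⊗₀ X₁)) → Set ℓ
  IsM h = (π₀ ∘ h ≡ π₀ ⊗₁ π₀) ×
          Σ (Summable (π₁ ⊗₁ π₀) (π₀ ⊗₁ π₁)) λ s → π₁ ∘ h ≡ σ ∘ proj₁ s

  IsNatural : (∀ X → Hom (!₀ (S₀ X)) (S₀ (!₀ X))) → Set (o ⊔ ℓ)
  IsNatural ∂ = ∀ {X Y} (f : Hom X Y) → S₁ (!₁ f) ∘ ∂ X ≡ ∂ Y ∘ !₁ (S₁ f)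

  DWith : (∀ X → Hom (!₀ (S₀ X)) (S₀ (!₀ X))) → Set (o ⊔ ℓ)
  DWith ∂ =
    (S₁ m⁰⁻¹ ∘ ∂ ⊤ ≡ ι₀ 𝟙 ∘ m⁰⁻¹ ∘ !₁ (0m {S₀ ⊤} {⊤})) ×
    (∀ X₀ X₁ → Σ (Hom (S₀ (!₀ X₀) ⊗₀ S₀ (!₀ X₁)) (S₀ (!₀ X₀ ⊗₀ !₀ X₁))) λ h →
       IsM h ×
       (S₁ (m²⁻¹ {X₀} {X₁}) ∘ ∂ (X₀ & X₁) ≡
          h ∘ (∂ X₀ ⊗₁ ∂ X₁) ∘ m²⁻¹ {S₀ X₀} {S₀ X₁} ∘ !₁ ⟨ S₁ pr₀ , S₁ pr₁ ⟩))

-- Weakening and contraction are !₁ of a map into a product (0 : X → ⊤, resp. ⟨id,id⟩ : X → X & X)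
-- followed by an inverse Seely isomorphism. Naturality of ∂ moves the !₁-part behind ∂, where it
-- becomes !₁ (S 0), resp. !₁ (S ⟨id,id⟩); (D-with) rewrites what remains in front, S(m⁰⁻¹) ∘ ∂ ⊤,
-- resp. S(m²⁻¹) ∘ ∂ (X & X), and the leftovers collapse: 0 ∘ S 0 = 0 and ⟨S pr₀, S pr₁⟩ ∘ S ⟨id,id⟩ = ⟨id,id⟩.
{-# OPTIONS --safe #-}
module Submission where

open import Defs
open import Level using (Level)
open import Data.Product using (_×_; _,_; proj₁)
open import Relation.Binary.PropositionalEquality using (_≡_; sym; trans; cong; module ≡-Reasoning)
open ResourceCategory using ()
open SummableResourceCategory using ()

module _ {o ℓ : Level} (L : SummableResourceCategory o ℓ) where
  open SummableResourceCategory L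
  open ResourceCategory RC
  open ≡-Reasoning

  Summable-unique : ∀ {X Y} {f₀ f₁ : Hom X Y} (s t : Summable f₀ f₁) → proj₁ s ≡ proj₁ t
  Summable-unique (h , h₀ , h₁) (h' , h'₀ , h'₁) =
    π-jointly-monic h h' (trans h₀ (sym h'₀)) (trans h₁ (sym h'₁))

  IsM-unique : ∀ {X₀ X₁} {h h' : Hom (S₀ X₀ ⊗₀ S₀ X₁) (S₀ (X₀ ⊗₀ X₁))} →
               IsM h → IsM h' → h ≡ h'
  IsM-unique {h = h} {h'} (h₀ , s , h₁) (h'₀ , s' , h'₁) =
    π-jointly-monic h h' (trans h₀ (sym h'₀))
      (trans h₁ (trans (cong (σ ∘_) (Summable-unique s s')) (sym h'₁)))

  S-pr-⟨⟩ : ∀ {Y X₀ X₁} (f₀ : Hom Y X₀) (f₁ : Hom Y X₁) →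
            ⟨ S₁ pr₀ , S₁ pr₁ ⟩ ∘ S₁ ⟨ f₀ , f₁ ⟩ ≡ ⟨ S₁ f₀ , S₁ f₁ ⟩
  S-pr-⟨⟩ f₀ f₁ = ⟨⟩-unique _ _ _ (S-pr f₀ f₁ pr₀ (pr₀-⟨⟩ _ _) (pr₀-⟨⟩ f₀ f₁))
                                  (S-pr f₀ f₁ pr₁ (pr₁-⟨⟩ _ _) (pr₁-⟨⟩ f₀ f₁))
    where
    S-pr : ∀ {Y X₀ X₁ Z} (f₀ : Hom Y X₀) (f₁ : Hom Y X₁) (p : Hom (X₀ & X₁) Z) {q} {f} →
           q ∘ ⟨ S₁ pr₀ , S₁ pr₁ ⟩ ≡ S₁ p → p ∘ ⟨ f₀ , f₁ ⟩ ≡ f →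
           q ∘ (⟨ S₁ pr₀ , S₁ pr₁ ⟩ ∘ S₁ ⟨ f₀ , f₁ ⟩) ≡ S₁ f
    S-pr f₀ f₁ p {q} {f} q-pr p-⟨⟩ = begin
      q ∘ (⟨ S₁ pr₀ , S₁ pr₁ ⟩ ∘ S₁ ⟨ f₀ , f₁ ⟩) ≡⟨ sym (assoc _ _ _) ⟩
      (q ∘ ⟨ S₁ pr₀ , S₁ pr₁ ⟩) ∘ S₁ ⟨ f₀ , f₁ ⟩ ≡⟨ cong (_∘ S₁ ⟨ f₀ , f₁ ⟩) q-pr ⟩
      S₁ p ∘ S₁ ⟨ f₀ , f₁ ⟩                     ≡⟨ sym (S-∘ _ _) ⟩
      S₁ (p ∘ ⟨ f₀ , f₁ ⟩)                      ≡⟨ cong S₁ p-⟨⟩ ⟩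
      S₁ f                                      ∎

  module _ (∂ : ∀ X → Hom (!₀ (S₀ X)) (S₀ (!₀ X))) (∂-nat : IsNatural ∂) where

    S-after-!-∂ : ∀ {X Y Z} (g : Hom (!₀ Y) Z) (f : Hom X Y) →
                  S₁ (g ∘ !₁ f) ∘ ∂ X ≡ (S₁ g ∘ ∂ Y) ∘ !₁ (S₁ f)
    S-after-!-∂ {X} {Y} g f = begin
      S₁ (g ∘ !₁ f) ∘ ∂ X        ≡⟨ cong (_∘ ∂ X) (S-∘ _ _) ⟩
      (S₁ g ∘ S₁ (!₁ f)) ∘ ∂ X   ≡⟨ assoc _ _ _ ⟩
      S₁ g ∘ (S₁ (!₁ f) ∘ ∂ X)   ≡⟨ cong (S₁ g ∘_) (∂-nat f) ⟩
      S₁ g ∘ (∂ Y ∘ !₁ (S₁ f))   ≡⟨ sym (assoc _ _ _) ⟩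
      (S₁ g ∘ ∂ Y) ∘ !₁ (S₁ f)   ∎

    ∂-weakening : S₁ m⁰⁻¹ ∘ ∂ ⊤ ≡ ι₀ 𝟙 ∘ m⁰⁻¹ ∘ !₁ (0m {S₀ ⊤} {⊤}) →
                  ∀ X → S₁ (w X) ∘ ∂ X ≡ ι₀ 𝟙 ∘ w (S₀ X)
    ∂-weakening ∂-⊤ X = begin
      S₁ (m⁰⁻¹ ∘ !₁ 0m) ∘ ∂ X                   ≡⟨ S-after-!-∂ m⁰⁻¹ 0m ⟩
      (S₁ m⁰⁻¹ ∘ ∂ ⊤) ∘ !₁ (S₁ 0m)              ≡⟨ cong (_∘ !₁ (S₁ 0m)) ∂-⊤ ⟩
      (ι₀ 𝟙 ∘ m⁰⁻¹ ∘ !₁ 0m) ∘ !₁ (S₁ 0m)        ≡⟨ trans (assoc _ _ _) (cong (ι₀ 𝟙 ∘_) (assoc _ _ _)) ⟩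
      ι₀ 𝟙 ∘ m⁰⁻¹ ∘ (!₁ 0m ∘ !₁ (S₁ 0m))        ≡⟨ cong (λ k → ι₀ 𝟙 ∘ m⁰⁻¹ ∘ k) (sym (!-∘ _ _)) ⟩
      ι₀ 𝟙 ∘ m⁰⁻¹ ∘ !₁ (0m ∘ S₁ 0m)             ≡⟨ cong (λ k → ι₀ 𝟙 ∘ m⁰⁻¹ ∘ !₁ k) (zeroˡ _) ⟩
      ι₀ 𝟙 ∘ m⁰⁻¹ ∘ !₁ 0m                       ∎

    ∂-contraction : ∀ X {h h' : Hom (S₀ (!₀ X) ⊗₀ S₀ (!₀ X)) (S₀ (!₀ X ⊗₀ !₀ X))} →
      IsM h' → S₁ (m²⁻¹ {X} {X}) ∘ ∂ (X & X) ≡ h' ∘ (∂ X ⊗₁ ∂ X) ∘ m²⁻¹ ∘ !₁ ⟨ S₁ pr₀ , S₁ pr₁ ⟩ →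
      IsM h → S₁ (c X) ∘ ∂ X ≡ h ∘ (∂ X ⊗₁ ∂ X) ∘ c (S₀ X)
    ∂-contraction X {h} {h'} h'-m ∂-& h-m = begin
      S₁ (m²⁻¹ ∘ !₁ ⟨ id , id ⟩) ∘ ∂ X                                       ≡⟨ S-after-!-∂ m²⁻¹ ⟨ id , id ⟩ ⟩
      (S₁ m²⁻¹ ∘ ∂ (X & X)) ∘ !₁ (S₁ ⟨ id , id ⟩)                            ≡⟨ cong (_∘ !₁ (S₁ ⟨ id , id ⟩)) ∂-& ⟩
      (h' ∘ ∂⊗∂ ∘ m²⁻¹ ∘ !₁ ⟨ S₁ pr₀ , S₁ pr₁ ⟩) ∘ !₁ (S₁ ⟨ id , id ⟩)         ≡⟨ assoc³ ⟩
      h' ∘ ∂⊗∂ ∘ m²⁻¹ ∘ (!₁ ⟨ S₁ pr₀ , S₁ pr₁ ⟩ ∘ !₁ (S₁ ⟨ id , id ⟩))        ≡⟨ cong (λ k → h' ∘ ∂⊗∂ ∘ m²⁻¹ ∘ k) (sym (!-∘ _ _)) ⟩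
      h' ∘ ∂⊗∂ ∘ m²⁻¹ ∘ !₁ (⟨ S₁ pr₀ , S₁ pr₁ ⟩ ∘ S₁ ⟨ id , id ⟩)             ≡⟨ cong (λ k → h' ∘ ∂⊗∂ ∘ m²⁻¹ ∘ !₁ k) (S-pr-⟨⟩ id id) ⟩
      h' ∘ ∂⊗∂ ∘ m²⁻¹ ∘ !₁ ⟨ S₁ id , S₁ id ⟩                                 ≡⟨ cong (λ k → h' ∘ ∂⊗∂ ∘ m²⁻¹ ∘ !₁ ⟨ k , k ⟩) S-id ⟩
      h' ∘ ∂⊗∂ ∘ m²⁻¹ ∘ !₁ ⟨ id , id ⟩                                       ≡⟨ cong (_∘ ∂⊗∂ ∘ c (S₀ X)) (IsM-unique h'-m h-m) ⟩
      h ∘ ∂⊗∂ ∘ m²⁻¹ ∘ !₁ ⟨ id , id ⟩                                        ∎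
      where
      ∂⊗∂ : Hom (!₀ (S₀ X) ⊗₀ !₀ (S₀ X)) (S₀ (!₀ X) ⊗₀ S₀ (!₀ X))
      ∂⊗∂ = ∂ X ⊗₁ ∂ X
      assoc³ : ∀ {A B C D E F} {a : Hom E F} {b : Hom D E} {c : Hom C D} {d : Hom B C} {e : Hom A B} →
               (a ∘ b ∘ c ∘ d) ∘ e ≡ a ∘ b ∘ c ∘ d ∘ e
      assoc³ = trans (assoc _ _ _) (cong (_ ∘_) (trans (assoc _ _ _) (cong (_ ∘_) (assoc _ _ _))))

mainTheorem6 : ∀ {o ℓ : Level} (L : SummableResourceCategory o ℓ) →
    let open SummableResourceCategory L
        open ResourceCategory RC
    in (∂ : ∀ X → Hom (!₀ (S₀ X)) (S₀ (!₀ X))) → IsNatural ∂ → DWith ∂ →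
       ∀ X → (S₁ (w X) ∘ ∂ X ≡ ι₀ 𝟙 ∘ w (S₀ X)) ×
             (∀ h → IsM { !₀ X } { !₀ X } h →
                S₁ (c X) ∘ ∂ X ≡ h ∘ (∂ X ⊗₁ ∂ X) ∘ c (S₀ X))
mainTheorem6 L ∂ ∂-nat (∂-⊤ , ∂-&) X =
  ∂-weakening L ∂ ∂-nat ∂-⊤ X ,
  λ h h-m → let h' , h'-m , ∂-X&X = ∂-& X X in ∂-contraction L ∂ ∂-nat X h'-m ∂-X&X h-m
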